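{- Let $G=(V,E)$ be an undirected graph (possibly with parallel edges) where every edge $e=(u,v)\in E$ has two non-negative weights $w_{u,e}$ and $w_{v,e}$, one for each endpoint. There exists an orientation $\mathcal{O}$ of the edges such that in the resulting digraph, for every vertex $v$, $$\sum_{e\in\Delta^-_{\mathcal{O}}(v)} w_{v,e}\ \ge\ \frac{\sum_{e\in\Delta(v)} w_{v,e}-\max_{e\in\Delta(v)} w_{v,e}}{2},$$ where $\Delta(v)$ is the set of edges incident on $v$ and $\Delta^-_{\mathcal O}(v)$ is the set of edges oriented towards $v$ under $\mathcal O$.
   Context: The maximum over an empty set is taken to be $0$ (so the inequality is trivial for isolated vertices).
   Formalization: The edge weights $w_{u,e}$ and $w_{v,e}$ are non-negative rationals rather than non-negative reals. -}

module Defs where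

open import Data.Nat using (ℕ)
open import Data.Fin using (Fin; _≟_)
open import Data.Fin.Base using ()
open import Data.Bool using (Bool; true; false)
open import Data.List using (List; []; _∷_; map; foldr; allFin)
open import Data.Product using (_×_; _,_; proj₁; proj₂)
open import Relation.Nullary using (yes; no; ¬_)
open import Relation.Binary.PropositionalEquality using (_≡_)
open import Data.Rational using (ℚ; 0ℚ; _+_; _⊔_; _≤_)

record WGraph (n m : ℕ) : Set where
  field
    end₁ end₂ : Fin m → Fin n
    noLoop    : ∀ e → ¬ (end₁ e ≡ end₂ e)
    w₁ w₂     : Fin m → ℚ        -- w₁ e = w_{end₁ e, e},  w₂ e = w_{end₂ e, e}
    w₁≥0      : ∀ e → 0ℚ ≤ w₁ e
    w₂≥0      : ∀ e → 0ℚ ≤ w₂ e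

-- An orientation: true means edge e is oriented end₁ → end₂ (towards end₂),
-- false means end₂ → end₁ (towards end₁).
Orientation : ℕ → Set
Orientation m = Fin m → Bool

sumℚ : List ℚ → ℚ
sumℚ = foldr _+_ 0ℚ

maxℚ : List ℚ → ℚ
maxℚ = foldr _⊔_ 0ℚ

module _ {n m : ℕ} (G : WGraph n m) where
  open WGraph G

  incW : Fin n → Fin m → List ℚ
  incW x e with x ≟ end₁ e | x ≟ end₂ e
  ... | yes _ | _     = w₁ e ∷ []
  ... | no _  | yes _ = w₂ e ∷ []
  ... | no _  | no _  = []

  inW : Orientation m → Fin n → Fin m → List ℚ
  inW O x e with O e | x ≟ end₁ e | x ≟ end₂ e
  ... | false | yes _ | _     = w₁ e ∷ []
  ... | true  | _     | yes _ = w₂ e ∷ []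
  ... | _     | _     | _     = []

  concatMapE : (Fin m → List ℚ) → List ℚ
  concatMapE f = foldr (λ e acc → Data.List._++_ (f e) acc) [] (allFin m)

  degW : Fin n → ℚ
  degW x = sumℚ (concatMapE (incW x))

  maxW : Fin n → ℚ
  maxW x = maxℚ (concatMapE (incW x))

  inDegW : Orientation m → Fin n → ℚ
  inDegW O x = sumℚ (concatMapE (inW O x))

-- Induction on the number of edges. Take a vertex v with an edge, and its two heaviest
-- incident weights x ≥ y, on edges v—u and v—u′ with far weights p and q. If v has a
-- single edge, orient it away from v. If u ≠ u′, contract the two edges into one edge
-- u—u′ with weights p, q, orient the smaller graph, and route that edge through v: u and
-- u′ receive what they received before, and v receives x or y. If u = u′, orient the two
-- parallel edges as a cycle that gives u the larger of p and q. At v the remaining edges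
-- satisfy s − m ≤ 2i with m ≤ y, hence y + s ≤ 2(i + y): an incoming weight of at least y
-- pays for adding x and y to the sum, since x becomes the maximum.

module Submission where

open import Defs
open import Algebra.Bundles using (CommutativeMonoid)
import Algebra.Properties.CommutativeSemigroup as CommutativeSemigroupProperties
open import Data.Bool using (Bool; true; false)
open import Data.Empty using (⊥-elim)
open import Data.Fin using (Fin; zero; suc; _≟_)
open import Data.List using (List; []; _∷_; _++_; foldr; concat; concatMap; map; length; tabulate; allFin)
open import Data.List.Properties using (++-assoc; foldr-map; map-tabulate; tabulate-cong; length-tabulate)
open import Data.List.Relation.Binary.Pointwise using (Pointwise; []; _∷_)
import Data.List.Relation.Binary.Pointwise.Properties as Pointwise
open import Data.List.Relation.Binary.Permutation.Propositional as ↭ using (_↭_; ↭-sym; ↭-reflexive)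
open import Data.List.Relation.Binary.Permutation.Propositional.Properties
  using (++⁺; ++⁺ˡ; ++-comm; shifts; All-resp-↭; ↭-length)
open import Data.List.Relation.Unary.All as All using (All; []; _∷_)
open import Data.List.Relation.Unary.All.Properties using (tabulate⁺) renaming (++⁺ to All-++⁺)
open import Data.Nat as ℕ using (ℕ; zero; suc)
import Data.Nat.Properties as ℕ
open import Data.Product using (∃; _×_; _,_; proj₁)
open import Data.Sum using (_⊎_; inj₁; inj₂)
open import Function using (_$_; _∘_; id)
open import Relation.Nullary using (yes; no)
open import Data.Rational using (ℚ; 0ℚ; _+_; _-_; _≤_; _⊔_; -_)
open import Data.Rational.Properties
  using (+-mono-≤; +-monoʳ-≤; +-monoˡ-≤; ≤-refl; ≤-trans; ≤-total; p≤p⊔q; p≤q⊔p; ⊔-lub; p≥q⇒p⊔q≡p;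
         +-0-commutativeMonoid; ⊔-commutativeSemigroup; module ≤-Reasoning)
open import Data.Rational.Solver using (module +-*-Solver)
open import Relation.Binary.PropositionalEquality
  using (_≡_; _≢_; refl; sym; cong; cong₂; trans; subst; subst₂; ≢-sym; module ≡-Reasoning)

open +-*-Solver

concatMap-↭ : {A B : Set} (f : A → List B) {xs ys : List A} → xs ↭ ys → concatMap f xs ↭ concatMap f ys
concatMap-↭ f ↭.refl = ↭.refl
concatMap-↭ f (↭.prep x p) = ++⁺ˡ (f x) (concatMap-↭ f p)
concatMap-↭ f (↭.swap x y p) =
  ↭.trans (shifts (f x) (f y)) (++⁺ˡ (f y) (++⁺ˡ (f x) (concatMap-↭ f p)))
concatMap-↭ f (↭.trans p q) = ↭.trans (concatMap-↭ f p) (concatMap-↭ f q)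

Pointwise-↭ : {A B : Set} {R : A → B → Set} {xs ys : List A} {zs : List B} →
              xs ↭ ys → Pointwise R ys zs → ∃ λ zs′ → Pointwise R xs zs′ × zs′ ↭ zs
Pointwise-↭ ↭.refl rs = _ , rs , ↭.refl
Pointwise-↭ (↭.prep x p) (r ∷ rs) with Pointwise-↭ p rs
... | _ , rs′ , σ = _ , r ∷ rs′ , ↭.prep _ σ
Pointwise-↭ (↭.swap x y p) (r ∷ s ∷ rs) with Pointwise-↭ p rs
... | _ , rs′ , σ = _ , s ∷ r ∷ rs′ , ↭.swap _ _ σ
Pointwise-↭ (↭.trans p q) rs with Pointwise-↭ q rs
... | _ , rs₁ , σ₁ with Pointwise-↭ p rs₁
... | _ , rs₂ , σ₂ = _ , rs₂ , ↭.trans σ₂ σ₁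

↭-shorter : ∀ {A : Set} {xs ys : List A} {y} → xs ↭ y ∷ ys → length ys ℕ.< length xs
↭-shorter σ = ℕ.≤-reflexive (sym (↭-length σ))

concatMap-allFin : ∀ {A B : Set} {k} (f : Fin k → List B) (g : A → List B) (h : Fin k → A) →
                   (∀ i → f i ≡ g (h i)) → foldr (λ i acc → f i ++ acc) [] (allFin k) ≡ concatMap g (tabulate h)
concatMap-allFin f g h f≗g∘h = begin
  foldr (λ i acc → f i ++ acc) [] (allFin _)   ≡⟨ foldr-map _++_ f [] (allFin _) ⟨
  concat (map f (tabulate id))                 ≡⟨ cong concat (map-tabulate id f) ⟩
  concat (tabulate f)                          ≡⟨ cong concat (tabulate-cong f≗g∘h) ⟩
  concat (tabulate (g ∘ h))                    ≡⟨ cong concat (map-tabulate h g) ⟨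
  concatMap g (tabulate h)                     ∎
  where open ≡-Reasoning

-- Not foldr-commMonoid: 0ℚ is no unit for _⊔_, and maxℚ folds _⊔_ from 0ℚ.
foldr-↭ : {A : Set} {_∙_ : A → A → A} (ε : A) → (∀ x y z → x ∙ (y ∙ z) ≡ y ∙ (x ∙ z)) →
          ∀ {xs ys} → xs ↭ ys → foldr _∙_ ε xs ≡ foldr _∙_ ε ys
foldr-↭ ε leftComm ↭.refl = refl
foldr-↭ {_∙_ = _∙_} ε leftComm (↭.prep x p) = cong (x ∙_) (foldr-↭ ε leftComm p)
foldr-↭ {_∙_ = _∙_} ε leftComm (↭.swap x y p) =
  trans (cong (λ z → x ∙ (y ∙ z)) (foldr-↭ ε leftComm p)) (leftComm x y _)
foldr-↭ ε leftComm (↭.trans p q) = trans (foldr-↭ ε leftComm p) (foldr-↭ ε leftComm q)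

sumℚ-↭ : ∀ {L L′} → L ↭ L′ → sumℚ L ≡ sumℚ L′
sumℚ-↭ = foldr-↭ 0ℚ (CommutativeSemigroupProperties.x∙yz≈y∙xz
                       (CommutativeMonoid.commutativeSemigroup +-0-commutativeMonoid))

maxℚ-↭ : ∀ {L L′} → L ↭ L′ → maxℚ L ≡ maxℚ L′
maxℚ-↭ = foldr-↭ 0ℚ (CommutativeSemigroupProperties.x∙yz≈y∙xz ⊔-commutativeSemigroup)

maxℚ-lub : ∀ {y L} → 0ℚ ≤ y → All (_≤ y) L → maxℚ L ≤ y
maxℚ-lub 0≤y []         = 0≤y
maxℚ-lub 0≤y (x≤y ∷ ≤y) = ⊔-lub x≤y (maxℚ-lub 0≤y ≤y)

-- The inequality at a vertex that sees the weights L on its incident edges and I on its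
-- incoming ones, with the subtraction cleared. A record rather than a synonym, so that
-- unification cannot unfold it and L, I stay inferable.
record WeightBound (L I : List ℚ) : Set where
  constructor weightBound
  field
    holds : sumℚ L ≤ (sumℚ I + sumℚ I) + maxℚ L

WeightBound-↭ : ∀ {L L′ I I′} → L ↭ L′ → I ↭ I′ → WeightBound L I → WeightBound L′ I′
WeightBound-↭ L↭L′ I↭I′ (weightBound bound) =
  weightBound (subst₂ _≤_ (sumℚ-↭ L↭L′) (cong₂ (λ i m → (i + i) + m) (sumℚ-↭ I↭I′) (maxℚ-↭ L↭L′)) bound)

WeightBound-[] : WeightBound [] []
WeightBound-[] = weightBound ≤-refl

WeightBound-sole : ∀ {x L I} → L ≡ [] → WeightBound L I → WeightBound (x ∷ L) I
WeightBound-sole {x} {I = I} refl (weightBound bound) = weightBound $ begin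
  x + 0ℚ                   ≤⟨ +-mono-≤ (p≤p⊔q x 0ℚ) bound ⟩
  (x ⊔ 0ℚ) + ((i + i) + 0ℚ) ≡⟨ solve 2 (λ a i → a :+ ((i :+ i) :+ con 0ℚ) := (i :+ i) :+ a) refl (x ⊔ 0ℚ) i ⟩
  (i + i) + (x ⊔ 0ℚ)       ∎
  where
  open ≤-Reasoning
  i = sumℚ I

WeightBound-received : ∀ {x L I} → 0ℚ ≤ x → WeightBound L I → WeightBound (x ∷ L) (x ∷ I)
WeightBound-received {x} {L} {I} 0≤x (weightBound bound) = weightBound $ begin
  x + s                          ≤⟨ +-monoʳ-≤ x (≤-trans bound (+-monoʳ-≤ (i + i) (p≤q⊔p x m))) ⟩
  x + ((i + i) + (x ⊔ m))        ≡⟨ solve 3 (λ x i a → x :+ ((i :+ i) :+ a) := (con 0ℚ :+ x) :+ ((i :+ i) :+ a))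
                                       refl x i (x ⊔ m) ⟩
  (0ℚ + x) + ((i + i) + (x ⊔ m)) ≤⟨ +-monoˡ-≤ _ (+-monoˡ-≤ x 0≤x) ⟩
  (x + x) + ((i + i) + (x ⊔ m))  ≡⟨ solve 3 (λ x i a → (x :+ x) :+ ((i :+ i) :+ a) := ((x :+ i) :+ (x :+ i)) :+ a)
                                       refl x i (x ⊔ m) ⟩
  ((x + i) + (x + i)) + (x ⊔ m)  ∎
  where
  open ≤-Reasoning
  s = sumℚ L
  m = maxℚ L
  i = sumℚ I

WeightBound-topTwo : ∀ {x y z L I} → 0ℚ ≤ y → y ≤ x → y ≤ z → All (_≤ y) L →
                     WeightBound L I → WeightBound (x ∷ y ∷ L) (z ∷ I)
WeightBound-topTwo {x} {y} {z} {L} {I} 0≤y y≤x y≤z ≤y (weightBound bound) = weightBound $ begin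
  x + (y + s)                         ≤⟨ +-monoʳ-≤ x (+-mono-≤ y≤z (≤-trans bound (+-monoʳ-≤ (i + i) m≤z))) ⟩
  x + (z + ((i + i) + z))             ≡⟨ solve 3 (λ x z i → x :+ (z :+ ((i :+ i) :+ z)) := ((z :+ i) :+ (z :+ i)) :+ x)
                                            refl x z i ⟩
  ((z + i) + (z + i)) + x             ≡⟨ cong (((z + i) + (z + i)) +_) max≡x ⟨
  ((z + i) + (z + i)) + (x ⊔ (y ⊔ m)) ∎
  where
  open ≤-Reasoning
  s = sumℚ L
  m = maxℚ L
  i = sumℚ I
  m≤y : m ≤ y
  m≤y = maxℚ-lub 0≤y ≤y
  m≤z : m ≤ z
  m≤z = ≤-trans m≤y y≤z
  max≡x : x ⊔ (y ⊔ m) ≡ x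
  max≡x = trans (cong (x ⊔_) (p≥q⇒p⊔q≡p m≤y)) (p≥q⇒p⊔q≡p y≤x)

WeightBound-pair : ∀ {p q z L I} → p ≤ z → q ≤ z → WeightBound L I → WeightBound (p ∷ q ∷ L) (z ∷ I)
WeightBound-pair {p} {q} {z} {L} {I} p≤z q≤z (weightBound bound) = weightBound $ begin
  p + (q + s)                ≤⟨ +-mono-≤ p≤z (+-mono-≤ q≤z (≤-trans bound (+-monoʳ-≤ (i + i) m≤max))) ⟩
  z + (z + ((i + i) + max))  ≡⟨ solve 3 (λ z i a → z :+ (z :+ ((i :+ i) :+ a)) := ((z :+ i) :+ (z :+ i)) :+ a)
                                   refl z i max ⟩
  ((z + i) + (z + i)) + max  ∎
  where
  open ≤-Reasoning
  s = sumℚ L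
  m = maxℚ L
  i = sumℚ I
  max = p ⊔ (q ⊔ m)
  m≤max : m ≤ max
  m≤max = ≤-trans (p≤q⊔p q m) (p≤q⊔p p (q ⊔ m))

WeightBound⇒sum-max≤in+in : ∀ {L I} → WeightBound L I → sumℚ L - maxℚ L ≤ sumℚ I + sumℚ I
WeightBound⇒sum-max≤in+in {L} {I} (weightBound bound) = begin
  sumℚ L - m          ≤⟨ +-monoˡ-≤ (- m) bound ⟩
  ((i + i) + m) - m   ≡⟨ solve 2 (λ j m → (j :+ m) :- m := j) refl (i + i) m ⟩
  i + i               ∎
  where
  open ≤-Reasoning
  m = maxℚ L
  i = sumℚ I

record Edge (n : ℕ) : Set where
  constructor edge
  field
    src dst   : Fin n
    wsrc wdst : ℚ

open Edge

module _ {n : ℕ} where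

  at : Fin n → Fin n → ℚ → List ℚ
  at w a x with w ≟ a
  ... | yes _ = x ∷ []
  ... | no _  = []

  at-self : ∀ a x → at a a x ≡ x ∷ []
  at-self a x with a ≟ a
  ... | yes _   = refl
  ... | no a≢a = ⊥-elim (a≢a refl)

  at-other : ∀ {w a} x → w ≢ a → at w a x ≡ []
  at-other {w} {a} x w≢a with w ≟ a
  ... | yes w≡a = ⊥-elim (w≢a w≡a)
  ... | no _    = refl

  incidentAt : Fin n → Edge n → List ℚ
  incidentAt w e = at w (src e) (wsrc e) ++ at w (dst e) (wdst e)

  incomingAt : Fin n → Edge n → List ℚ
  incomingAt w e = at w (dst e) (wdst e)

  incident : Fin n → List (Edge n) → List ℚ
  incident w = concatMap (incidentAt w)

  incoming : Fin n → List (Edge n) → List ℚ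
  incoming w = concatMap (incomingAt w)

  flip : Edge n → Edge n
  flip e = edge (dst e) (src e) (wdst e) (wsrc e)

  orient : Edge n → Bool → Edge n
  orient e true  = e
  orient e false = flip e

  Reorientation : Edge n → Edge n → Set
  Reorientation e o = ∃ λ b → o ≡ orient e b

  Reorientation-refl : ∀ {e} → Reorientation e e
  Reorientation-refl = true , refl

  Reorientation-trans : ∀ {e e′ o} → Reorientation e e′ → Reorientation e′ o → Reorientation e o
  Reorientation-trans (b     , refl) (true  , refl) = b , refl
  Reorientation-trans (true  , refl) (false , refl) = false , refl
  Reorientation-trans (false , refl) (false , refl) = true , refl

  incidentAt-flip : ∀ w e → incidentAt w (flip e) ↭ incidentAt w e
  incidentAt-flip w e = ++-comm (at w (dst e) (wdst e)) (at w (src e) (wsrc e))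

  incident-reorient : ∀ w {es os} → Pointwise Reorientation es os → incident w os ↭ incident w es
  incident-reorient w [] = ↭.refl
  incident-reorient w ((true  , refl) ∷ ρs) = ++⁺ˡ _ (incident-reorient w ρs)
  incident-reorient w {e ∷ _} ((false , refl) ∷ ρs) = ++⁺ (incidentAt-flip w e) (incident-reorient w ρs)

  WellFormed : Edge n → Set
  WellFormed e = src e ≢ dst e × 0ℚ ≤ wsrc e × 0ℚ ≤ wdst e

  WellFormed-reorient : ∀ {e o} → Reorientation e o → WellFormed e → WellFormed o
  WellFormed-reorient (true  , refl) wf = wf
  WellFormed-reorient (false , refl) (loopFree , 0≤s , 0≤d) = ≢-sym loopFree , 0≤d , 0≤s

  Orientable : List (Edge n) → Set
  Orientable es = ∃ λ os → Pointwise Reorientation es os × ∀ w → WeightBound (incident w es) (incoming w os)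

  Orientable-↭ : ∀ {es es′} → es ↭ es′ → Orientable es′ → Orientable es
  Orientable-↭ σ (os′ , ρs′ , bound) with Pointwise-↭ σ ρs′
  ... | os , ρs , τ =
    os , ρs , λ w → WeightBound-↭ (concatMap-↭ (incidentAt w) (↭-sym σ)) (concatMap-↭ (incomingAt w) (↭-sym τ)) (bound w)

  Orientable-reorient : ∀ {es es′} → Pointwise Reorientation es es′ → Orientable es′ → Orientable es
  Orientable-reorient ρs (os , ρs′ , bound) =
    os , Pointwise.transitive Reorientation-trans ρs ρs′ ,
    λ w → WeightBound-↭ {I = incoming w os} (incident-reorient w ρs) ↭.refl (bound w)

  record Endpoint (v : Fin n) (e : Edge n) : Set where
    constructor endpoint
    field
      {far}             : Fin n
      {weight}          : ℚ
      {farWeight}       : ℚ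
      reorientation     : Reorientation e (edge v far weight farWeight)
      incidentAt≡weight : incidentAt v e ≡ weight ∷ []

  open Endpoint

  srcEndpoint : ∀ e → src e ≢ dst e → Endpoint (src e) e
  srcEndpoint e loopFree = endpoint (true , refl) (cong₂ _++_ (at-self _ _) (at-other _ loopFree))

  dstEndpoint : ∀ e → src e ≢ dst e → Endpoint (dst e) e
  dstEndpoint e loopFree = endpoint (false , refl) (cong₂ _++_ (at-other _ (≢-sym loopFree)) (at-self _ _))

  endpoint? : ∀ v e → src e ≢ dst e → incidentAt v e ≡ [] ⊎ Endpoint v e
  endpoint? v e loopFree with v ≟ src e | v ≟ dst e
  ... | yes refl | _        = inj₂ (srcEndpoint e loopFree)
  ... | no _     | yes refl = inj₂ (dstEndpoint e loopFree)
  ... | no _     | no _     = inj₁ refl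

  record Heaviest (v : Fin n) (es : List (Edge n)) : Set where
    constructor heaviest
    field
      {heavy}   : Edge n
      others    : List (Edge n)
      split     : es ↭ heavy ∷ others
      heavyEnd  : Endpoint v heavy
      dominates : All (_≤ weight heavyEnd) (incident v others)

  open Heaviest

  incident-heaviest : ∀ {v es} (H : Heaviest v es) →
                      incident v es ↭ weight (heavyEnd H) ∷ incident v (others H)
  incident-heaviest {v} (heaviest others σ ep _) =
    ↭.trans (concatMap-↭ (incidentAt v) σ) (↭-reflexive (cong (_++ incident v others) (incidentAt≡weight ep)))

  heaviest-dominates : ∀ {v es} (H : Heaviest v es) → All (_≤ weight (heavyEnd H)) (incident v es)
  heaviest-dominates H = All-resp-↭ (↭-sym (incident-heaviest H)) (≤-refl ∷ dominates H)

  heaviest-skip : ∀ {v c cs} (H : Heaviest v cs) → All (_≤ weight (heavyEnd H)) (incidentAt v c) →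
                  Heaviest v (c ∷ cs)
  heaviest-skip {c = c} (heaviest {e} others σ ep dom) c≤ =
    heaviest (c ∷ others) (↭.trans (↭.prep c σ) (↭.swap c e ↭.refl)) ep (All-++⁺ c≤ dom)

  heaviest-∷ : ∀ {v c cs} → Endpoint v c → incident v cs ≡ [] ⊎ Heaviest v cs → Heaviest v (c ∷ cs)
  heaviest-∷ ep (inj₁ none) = heaviest _ ↭.refl ep (subst (All _) (sym none) [])
  heaviest-∷ ep (inj₂ H) with ≤-total (weight (heavyEnd H)) (weight ep)
  ... | inj₁ H≤ep = heaviest _ ↭.refl ep (All.map (λ r≤H → ≤-trans r≤H H≤ep) (heaviest-dominates H))
  ... | inj₂ ep≤H = heaviest-skip H (subst (All _) (sym (incidentAt≡weight ep)) (ep≤H ∷ []))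

  heaviest? : ∀ v es → All WellFormed es → incident v es ≡ [] ⊎ Heaviest v es
  heaviest? v []       []         = inj₁ refl
  heaviest? v (c ∷ cs) (wf ∷ wfs) with endpoint? v c (proj₁ wf) | heaviest? v cs wfs
  ... | inj₂ ep   | found     = inj₂ (heaviest-∷ ep found)
  ... | inj₁ away | inj₁ none = inj₁ (cong₂ _++_ away none)
  ... | inj₁ away | inj₂ H    = inj₂ (heaviest-skip H (subst (All _) (sym away) []))

  Orientable-pendant : ∀ {v u x p rest} → v ≢ u → 0ℚ ≤ p → incident v rest ≡ [] →
                       Orientable rest → Orientable (edge v u x p ∷ rest)
  Orientable-pendant {v} {u} {x} {p} {rest} v≢u 0≤p isolated (os , ρs , bound) =
    edge v u x p ∷ os , Reorientation-refl ∷ ρs , local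
    where
    local : ∀ w → WeightBound (incident w (edge v u x p ∷ rest)) (incoming w (edge v u x p ∷ os))
    -- Abstracting w ≟ v and w ≟ u makes every `at w v _` and `at w u _` in the goal compute.
    local w with w ≟ v | w ≟ u
    ... | yes refl | yes v≡u  = ⊥-elim (v≢u v≡u)
    ... | yes refl | no _     = WeightBound-sole isolated (bound v)
    ... | no _     | yes refl = WeightBound-received 0≤p (bound u)
    ... | no _     | no _     = bound w

  Orientable-subdivide : ∀ {v u u′ x y p q rest} → v ≢ u → v ≢ u′ → 0ℚ ≤ y → y ≤ x →
                         All (_≤ y) (incident v rest) →
                         Orientable (edge u u′ p q ∷ rest) → Orientable (edge v u x p ∷ edge v u′ y q ∷ rest)
  Orientable-subdivide {v} {u} {u′} {x} {y} {p} {q} {rest} v≢u v≢u′ 0≤y y≤x dominated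
                       (_ ∷ os , (true , refl) ∷ ρs , bound) =
    edge u v p x ∷ edge v u′ y q ∷ os , (false , refl) ∷ (true , refl) ∷ ρs , local
    where
    local : ∀ w → WeightBound (incident w (edge v u x p ∷ edge v u′ y q ∷ rest))
                              (incoming w (edge u v p x ∷ edge v u′ y q ∷ os))
    local w with w ≟ v
    ... | no _ = subst (λ L → WeightBound L _) (++-assoc (at w u p) (at w u′ q) (incident w rest)) (bound w)
    -- Abstracting bound v as well lets `at v u p` and `at v u′ q` compute in its type.
    ... | yes refl with v ≟ u | v ≟ u′ | bound v
    ...   | yes v≡u | _        | _       = ⊥-elim (v≢u v≡u)
    ...   | no _    | yes v≡u′ | _       = ⊥-elim (v≢u′ v≡u′)
    ...   | no _    | no _     | bound-v = WeightBound-topTwo 0≤y y≤x y≤x dominated bound-v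
  Orientable-subdivide {v} {u} {u′} {x} {y} {p} {q} {rest} v≢u v≢u′ 0≤y y≤x dominated
                       (_ ∷ os , (false , refl) ∷ ρs , bound) =
    edge v u x p ∷ edge u′ v q y ∷ os , (true , refl) ∷ (false , refl) ∷ ρs , local
    where
    local : ∀ w → WeightBound (incident w (edge v u x p ∷ edge v u′ y q ∷ rest))
                              (incoming w (edge v u x p ∷ edge u′ v q y ∷ os))
    local w with w ≟ v
    ... | no _ = subst (λ L → WeightBound L _) (++-assoc (at w u p) (at w u′ q) (incident w rest)) (bound w)
    ... | yes refl with v ≟ u | v ≟ u′ | bound v
    ...   | yes v≡u | _        | _       = ⊥-elim (v≢u v≡u)
    ...   | no _    | yes v≡u′ | _       = ⊥-elim (v≢u′ v≡u′)
    ...   | no _    | no _     | bound-v = WeightBound-topTwo 0≤y y≤x ≤-refl dominated bound-v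

  Orientable-twoCycle : ∀ {v u x y p q rest} → v ≢ u → 0ℚ ≤ y → y ≤ x → All (_≤ y) (incident v rest) →
                        Orientable rest → Orientable (edge v u x p ∷ edge v u y q ∷ rest)
  Orientable-twoCycle {v} {u} {x} {y} {p} {q} {rest} v≢u 0≤y y≤x dominated (os , ρs , bound)
    with ≤-total q p
  ... | inj₁ q≤p = edge v u x p ∷ edge u v q y ∷ os , (true , refl) ∷ (false , refl) ∷ ρs , local
    where
    local : ∀ w → WeightBound (incident w (edge v u x p ∷ edge v u y q ∷ rest))
                              (incoming w (edge v u x p ∷ edge u v q y ∷ os))
    local w with w ≟ v | w ≟ u
    ... | yes refl | yes v≡u  = ⊥-elim (v≢u v≡u)
    ... | yes refl | no _     = WeightBound-topTwo 0≤y y≤x ≤-refl dominated (bound v)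
    ... | no _     | yes refl = WeightBound-pair ≤-refl q≤p (bound u)
    ... | no _     | no _     = bound w
  ... | inj₂ p≤q = edge u v p x ∷ edge v u y q ∷ os , (false , refl) ∷ (true , refl) ∷ ρs , local
    where
    local : ∀ w → WeightBound (incident w (edge v u x p ∷ edge v u y q ∷ rest))
                              (incoming w (edge u v p x ∷ edge v u y q ∷ os))
    local w with w ≟ v | w ≟ u
    ... | yes refl | yes v≡u  = ⊥-elim (v≢u v≡u)
    ... | yes refl | no _     = WeightBound-topTwo 0≤y y≤x y≤x dominated (bound v)
    ... | no _     | yes refl = WeightBound-pair p≤q ≤-refl (bound u)
    ... | no _     | no _     = bound w

  orientable-step : ∀ {v es} → (∀ es′ → length es′ ℕ.< length es → All WellFormed es′ → Orientable es′) →
                    All WellFormed es → Heaviest v es → Orientable es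
  orientable-step {v} {es} ih wfs (heaviest {E} rest₁ σ₁ (endpoint {u} {x} {p} ρE _) dom₁)
    with All-resp-↭ σ₁ wfs
  ... | wfE ∷ wfs₁ with WellFormed-reorient ρE wfE | heaviest? v rest₁ wfs₁
  ... | v≢u , _ , 0≤p | inj₁ isolated =
    Orientable-↭ σ₁ (Orientable-reorient (ρE ∷ Pointwise.refl Reorientation-refl)
      (Orientable-pendant v≢u 0≤p isolated (ih rest₁ (↭-shorter σ₁) wfs₁)))
  ... | v≢u , _ , 0≤p | inj₂ H₂@(heaviest rest₂ σ₂ (endpoint {u′} {y} {q} ρF _) dom₂)
    with All-resp-↭ σ₂ wfs₁
  ... | wfF ∷ wfs₂ with WellFormed-reorient ρF wfF
  ... | v≢u′ , 0≤y , 0≤q =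
    Orientable-↭ (↭.trans σ₁ (↭.prep E σ₂))
      (Orientable-reorient (ρE ∷ ρF ∷ Pointwise.refl Reorientation-refl) fork)
    where
    y≤x : y ≤ x
    y≤x = All.head (All-resp-↭ (incident-heaviest H₂) dom₁)
    shorter₂ : suc (length rest₂) ℕ.< length es
    shorter₂ = subst (ℕ._< length es) (↭-length σ₂) (↭-shorter σ₁)
    fork : Orientable (edge v u x p ∷ edge v u′ y q ∷ rest₂)
    fork with u ≟ u′
    ... | no u≢u′ = Orientable-subdivide v≢u v≢u′ 0≤y y≤x dom₂
                      (ih (edge u u′ p q ∷ rest₂) shorter₂ ((u≢u′ , 0≤p , 0≤q) ∷ wfs₂))
    ... | yes refl = Orientable-twoCycle v≢u 0≤y y≤x dom₂
                       (ih rest₂ (ℕ.<-trans (ℕ.n<1+n _) shorter₂) wfs₂)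

  orientable : ∀ k es → length es ℕ.≤ k → All WellFormed es → Orientable es
  orientable k       []       _   _   = [] , [] , λ _ → WeightBound-[]
  orientable (suc k) (e ∷ es) len wfs =
    orientable-step (λ es′ shorter → orientable k es′ (ℕ.≤-trans (ℕ.s≤s⁻¹ shorter) (ℕ.s≤s⁻¹ len))) wfs
      (heaviest-∷ (srcEndpoint e (proj₁ (All.head wfs))) (heaviest? (src e) es (All.tail wfs)))

  reorientation-tabulate : ∀ {k} (h : Fin k → Edge n) {os} → Pointwise Reorientation (tabulate h) os →
                           ∃ λ (c : Fin k → Bool) → os ≡ tabulate (λ i → orient (h i) (c i))
  reorientation-tabulate {zero}  h []                = (λ ()) , refl
  reorientation-tabulate {suc k} h ((b , refl) ∷ ρs) with reorientation-tabulate (h ∘ suc) ρs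
  ... | c , refl = (λ { zero → b ; (suc i) → c i }) , refl

module WeightedGraph {n m : ℕ} (G : WGraph n m) where
  open WGraph G

  edgeOf : Fin m → Edge n
  edgeOf i = edge (end₁ i) (end₂ i) (w₁ i) (w₂ i)

  edgeOf-wellFormed : ∀ i → WellFormed (edgeOf i)
  edgeOf-wellFormed i = noLoop i , w₁≥0 i , w₂≥0 i

  incW≡incidentAt : ∀ x i → incW G x i ≡ incidentAt x (edgeOf i)
  incW≡incidentAt x i with x ≟ end₁ i | x ≟ end₂ i
  ... | yes refl | yes x≡end₂ = ⊥-elim (noLoop i x≡end₂)
  ... | yes _    | no _       = refl
  ... | no _     | yes _      = refl
  ... | no _     | no _       = refl

  inW≡incomingAt : ∀ O x i → inW G O x i ≡ incomingAt x (orient (edgeOf i) (O i))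
  inW≡incomingAt O x i with O i
  ... | true  with x ≟ end₂ i
  ...   | yes _ = refl
  ...   | no _  = refl
  inW≡incomingAt O x i | false with x ≟ end₁ i
  ...   | yes _ = refl
  ...   | no _  = refl

  degree≡ : ∀ x → concatMapE G (incW G x) ≡ incident x (tabulate edgeOf)
  degree≡ x = concatMap-allFin (incW G x) (incidentAt x) edgeOf (incW≡incidentAt x)

  inDegree≡ : ∀ O x → concatMapE G (inW G O x) ≡ incoming x (tabulate (λ i → orient (edgeOf i) (O i)))
  inDegree≡ O x =
    concatMap-allFin (inW G O x) (incomingAt x) (λ i → orient (edgeOf i) (O i)) (inW≡incomingAt O x)

open WeightedGraph

theorem6 : (n m : ℕ) (G : WGraph n m) →
    ∃ λ (O : Orientation m) → ∀ (x : Fin n) →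
      degW G x - maxW G x ≤ inDegW G O x + inDegW G O x
theorem6 n m G
  with os , ρs , bound ← orientable m (tabulate (edgeOf G)) (ℕ.≤-reflexive (length-tabulate (edgeOf G)))
                                     (tabulate⁺ (edgeOf-wellFormed G))
  with O , refl ← reorientation-tabulate (edgeOf G) ρs
  = O , λ x → WeightBound⇒sum-max≤in+in (subst₂ WeightBound (sym (degree≡ G x)) (sym (inDegree≡ G O x)) (bound x))
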